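{- Let $\mathcal C$ be a 3XOR instance with $\mathrm{val}(\mathcal C)\ge1-\epsilon$. Then $\mathrm{GI}(G_{\mathcal C},G_{\overline{\mathcal C}})\ge1-2\epsilon/3$.
   Context: A 3XOR instance $\mathcal C$ over variable set $\mathcal X$ is a list of equations $C$: $x_{1}+x_{2}+x_{3}=b$ over $\mathbb Z_2$ on three distinct variables; $\mathrm{val}(\mathcal C)$ is the maximum over assignments $\tau:\mathcal X\to\mathbb Z_2$ of the fraction of satisfied equations. The homogeneous version $\overline C$ of $C$ is $x_1+x_2+x_3=0$, and $\overline{\mathcal C}=\{\overline C:C\in\mathcal C\}$. Graph $G_{\mathcal C}$: for each $x\in\mathcal X$ and $a\in\mathbb Z_2$ there is a variable vertex "$x\mapsto a$", and $x\mapsto0$, $x\mapsto1$ are joined by an edge. For each constraint $C\in\mathcal C$ on variables $x_1,x_2,x_3$ there are 4 constraint vertices, one for each partial assignment $\alpha=(x_1\mapsto a_1,x_2\mapsto a_2,x_3\mapsto a_3)$ satisfying $C$ (distinct constraints get distinct constraint vertices); these 4 form a clique, and each is joined to the three variable vertices $x_i\mapsto a_i$ it is consistent with. Variable vertices are shared among all constraints. With $n$ variables and $m$ constraints, $G_{\mathcal C}$ has $4m+2n$ vertices and $18m+n$ edges. For graphs $G,H$ with equal vertex counts, $\mathrm{GI}(G,H)=\max_\pi |\{e\in E(G):\pi(e)\in E(H)\}|/\max\{|E(G)|,|E(H)|\}$ over bijections $\pi:V(G)\to V(H)$.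
   Formalization: The parameter ε ranges over the rationals. -}

module Defs where

open import Data.Bool using (Bool; true; false; _∧_; _∨_; _xor_; not; if_then_else_)
open import Data.Nat as ℕ using (ℕ; zero; suc; NonZero; _<ᵇ_)
open import Data.Fin using (Fin; zero; suc; toℕ; splitAt; remQuot)
open import Data.Fin.Properties using (_≟_)
open import Data.Vec using (Vec; []; _∷_; lookup; toList)
open import Data.List using (List; []; _∷_; map; concatMap; filter; foldr; sum; allFin; length)
open import Data.Product using (_×_; _,_)
open import Data.Sum using (inj₁; inj₂)
open import Data.Integer using (+_)
open import Data.Rational using (ℚ; _/_; _⊔_; 0ℚ; 1ℚ)
open import Relation.Binary.PropositionalEquality using (_≢_)
open import Relation.Nullary.Decidable using (⌊_⌋)

-- Z₂ is represented by Bool (false = 0, true = 1, addition = xor).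

record Eqn (n : ℕ) : Set where
  field
    x₁ x₂ x₃ : Fin n
    x₁≢x₂ : x₁ ≢ x₂
    x₁≢x₃ : x₁ ≢ x₃
    x₂≢x₃ : x₂ ≢ x₃
    b : Bool
open Eqn public

Instance : ℕ → ℕ → Set
Instance n m = Vec (Eqn n) m

homEqn : ∀ {n} → Eqn n → Eqn n
homEqn C = record C { b = false }

homInst : ∀ {n m} → Instance n m → Instance n m
homInst = Data.Vec.map homEqn

satisfies : ∀ {n} → (Fin n → Bool) → Eqn n → Bool
satisfies τ C = not ((τ (x₁ C) xor τ (x₂ C) xor τ (x₃ C)) xor b C)

count : ∀ {A : Set} → (A → Bool) → List A → ℕ
count p xs = length (filter (λ x → Data.Bool._≟_ (p x) true) xs)

allVecs : ∀ {A : Set} → List A → (k : ℕ) → List (Vec A k)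
allVecs xs zero = [] ∷ []
allVecs xs (suc k) = concatMap (λ x → map (x ∷_) (allVecs xs k)) xs

-- Maximum of a list of rationals (only used on nonempty lists).
maxℚ : List ℚ → ℚ
maxℚ [] = 0ℚ
maxℚ (q ∷ qs) = foldr _⊔_ q qs

numSat : ∀ {n m} → Instance n m → (Fin n → Bool) → ℕ
numSat 𝒞 τ = count (satisfies τ) (toList 𝒞)

val : ∀ {n m} → .{{_ : NonZero m}} → Instance n m → ℚ
val {n} {m} 𝒞 =
  maxℚ (map (λ τ → (+ numSat 𝒞 (lookup τ)) / m) (allVecs (false ∷ true ∷ []) n))

record Graph (N : ℕ) : Set where
  field
    adj : Fin N → Fin N → Bool
open Graph public

numEdges : ∀ {N} → Graph N → ℕ
numEdges {N} G =
  count (λ p → (toℕ (Data.Product.proj₁ p) <ᵇ toℕ (Data.Product.proj₂ p))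
               ∧ adj G (Data.Product.proj₁ p) (Data.Product.proj₂ p))
        (concatMap (λ i → map (i ,_) (allFin N)) (allFin N))

numPreserved : ∀ {N} → Graph N → Graph N → (Fin N → Fin N) → ℕ
numPreserved {N} G H π =
  count (λ p → (toℕ (Data.Product.proj₁ p) <ᵇ toℕ (Data.Product.proj₂ p))
               ∧ adj G (Data.Product.proj₁ p) (Data.Product.proj₂ p)
               ∧ adj H (π (Data.Product.proj₁ p)) (π (Data.Product.proj₂ p)))
        (concatMap (λ i → map (i ,_) (allFin N)) (allFin N))

_==ᶠ_ : ∀ {N} → Fin N → Fin N → Bool
i ==ᶠ j = ⌊ i ≟ j ⌋

allB : ∀ {A : Set} → List A → (A → Bool) → Bool
allB xs p = foldr (λ x r → p x ∧ r) true xs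

anyB : ∀ {A : Set} → List A → (A → Bool) → Bool
anyB xs p = foldr (λ x r → p x ∨ r) false xs

isBijection : ∀ {N} → (Fin N → Fin N) → Bool
isBijection {N} f =
  allB (allFin N) (λ i → allB (allFin N) (λ j →
        not (f i ==ᶠ f j) ∨ (i ==ᶠ j)))
  ∧ allB (allFin N) (λ y → anyB (allFin N) (λ i → f i ==ᶠ y))

bijections : (N : ℕ) → List (Vec (Fin N) N)
bijections N = filter (λ v → Data.Bool._≟_ (isBijection (lookup v)) true)
                      (allVecs (allFin N) N)

-- GI(G,H) = max_π |{e ∈ E(G) : π(e) ∈ E(H)}| / max{|E(G)|,|E(H)|}.
-- (Convention: if both graphs are edgeless the denominator is 0 and we set
--  GI = 1; this case never arises for the graphs G_𝒞 below.)
GI : ∀ {N} → Graph N → Graph N → ℚ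
GI {N} G H with numEdges G ℕ.⊔ numEdges H
... | zero = 1ℚ
... | suc d = maxℚ (map (λ π → (+ numPreserved G H (lookup π)) / suc d) (bijections N))

-- Vertex encoding: Fin (n * 2 + m * 4).
--   * the first n*2 vertices are variable vertices (x ↦ a), via remQuot 2 : (x , a);
--   * the remaining m*4 are constraint vertices (C_j , k), via remQuot 4 : (j , k).
-- Constraint vertex k ∈ Fin 4 = Fin (2*2), decoded as (k₁ , k₂) by remQuot 2,
-- stands for the satisfying partial assignment
--   (x₁ ↦ a₁ , x₂ ↦ a₂ , x₃ ↦ b + a₁ + a₂)  with a₁ = k₁, a₂ = k₂;
-- these are exactly the 4 satisfying assignments of x₁+x₂+x₃ = b.

bit : Fin 2 → Bool
bit zero = false
bit (suc _) = true

data Vtx (n m : ℕ) : Set where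
  var : Fin n → Bool → Vtx n m
  con : Fin m → Fin 4 → Vtx n m

decode : ∀ {n m} → Fin (n ℕ.* 2 ℕ.+ m ℕ.* 4) → Vtx n m
decode {n} {m} i with splitAt (n ℕ.* 2) i
... | inj₁ v with remQuot {n} 2 v
...   | (x , a) = var x (bit a)
decode {n} {m} i | inj₂ c with remQuot {m} 4 c
...   | (j , k) = con j k

_==ᵇ_ : Bool → Bool → Bool
a ==ᵇ c = not (a xor c)

val₁ val₂ val₃ : ∀ {n} → Eqn n → Fin 4 → Bool
val₁ C k with remQuot {2} 2 k
... | (k₁ , k₂) = bit k₁
val₂ C k with remQuot {2} 2 k
... | (k₁ , k₂) = bit k₂
val₃ C k with remQuot {2} 2 k
... | (k₁ , k₂) = b C xor bit k₁ xor bit k₂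

consistent : ∀ {n} → Eqn n → Fin 4 → Fin n → Bool → Bool
consistent C k x a =
     ((x₁ C ==ᶠ x) ∧ (val₁ C k ==ᵇ a))
  ∨ ((x₂ C ==ᶠ x) ∧ (val₂ C k ==ᵇ a))
  ∨ ((x₃ C ==ᶠ x) ∧ (val₃ C k ==ᵇ a))

adjVtx : ∀ {n m} → Instance n m → Vtx n m → Vtx n m → Bool
adjVtx 𝒞 (var x a) (var y c) = (x ==ᶠ y) ∧ not (a ==ᵇ c)
adjVtx 𝒞 (con j k) (con j' k') = (j ==ᶠ j') ∧ not (k ==ᶠ k')
adjVtx 𝒞 (var x a) (con j k) = consistent (lookup 𝒞 j) k x a
adjVtx 𝒞 (con j k) (var x a) = consistent (lookup 𝒞 j) k x a

G[_] : ∀ {n m} → Instance n m → Graph (n ℕ.* 2 ℕ.+ m ℕ.* 4)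
G[ 𝒞 ] = record { adj = λ u v → adjVtx 𝒞 (decode u) (decode v) }

module Submission where

-- Fix an assignment τ attaining val 𝒞 and satisfying s of the m equations, and translate every
-- vertex by τ: x ↦ a goes to x ↦ a + τ(x), and a satisfying partial assignment α of C goes to
-- α + τ|C. The first two values of α + τ|C determine a satisfying assignment of the homogeneous
-- equation, whose third value agrees with α(x₃) + τ(x₃) exactly when τ satisfies C. Hence this
-- involution of the vertex set preserves every variable edge, every clique edge, and the 12
-- variable–constraint edges of each satisfied equation: at least n + 6m + 12s of the n + 18m
-- edges. As s ≥ (1 - ε)m, the ratio is at least 1 - 12(m - s)/(18m) ≥ 1 - 2ε/3.

open import Defs
open import Algebra.Bundles using (CommutativeRing)
open import Data.Bool as Bool using (Bool; true; false; T; _∧_; _∨_; _xor_; not)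
import Data.Bool.Properties as Bool
open import Data.Empty using (⊥-elim)
open import Data.Fin as Fin using (Fin; zero; suc; _↑ˡ_; _↑ʳ_; combine)
import Data.Fin.Properties as Fin
import Data.Integer as ℤ
import Data.Integer.Properties as ℤ
open import Data.List using (List; []; _∷_; _++_; map; concatMap; tabulate; allFin; foldr)
open import Data.List.Membership.Propositional using (_∈_)
open import Data.List.Membership.Propositional.Properties
  using (∈-allFin; ∈-map⁺; ∈-map⁻; ∈-concatMap⁺; ∈-filter⁺)
import Data.List.Properties as List
open import Data.List.Relation.Unary.Any as Any using (here; there)
open import Data.Nat as ℕ using (ℕ; zero; suc; _+_; _*_; NonZero)
import Data.Nat.Properties as ℕ
open import Data.Nat.Tactic.RingSolver using (solve-∀)
open import Data.Product using (_×_; _,_; proj₁; proj₂; uncurry; ∃)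
open import Data.Rational as ℚ using (ℚ; _/_; 1ℚ)
import Data.Rational.Properties as ℚ
open import Data.Rational.Solver using (module +-*-Solver)
open import Data.Rational.Unnormalised as ℚᵘ using (ℚᵘ)
import Data.Rational.Unnormalised.Properties as ℚᵘ
open import Data.Sum using (inj₁; inj₂)
open import Data.Unit using (tt)
open import Data.Vec as Vec using (Vec; []; _∷_; toList; lookup)
import Data.Vec.Properties as Vec
open import Function using (_∘_; id)
open import Relation.Binary.PropositionalEquality
open import Relation.Nullary using (yes; no; contradiction)
open import Relation.Nullary.Decidable using (dec-true; dec-false; isYes≗does)

open import Algebra.Properties.Semiring.Sum ℕ.+-*-semiring
  using (sum; sum-syntax; sum-cong-≗; ∑-distrib-+; ∑-comm; *-distribˡ-sum)

==ᶠ⇒≡ : ∀ {N} {i j : Fin N} → (i ==ᶠ j) ≡ true → i ≡ j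
==ᶠ⇒≡ {i = i} {j} i==j with i Fin.≟ j
... | yes i≡j = i≡j

≢⇒==ᶠ-false : ∀ {N} {i j : Fin N} → i ≢ j → (i ==ᶠ j) ≡ false
≢⇒==ᶠ-false {i = i} {j} i≢j = trans (isYes≗does (i Fin.≟ j)) (dec-false (i Fin.≟ j) i≢j)

==ᶠ-refl : ∀ {N} (i : Fin N) → (i ==ᶠ i) ≡ true
==ᶠ-refl i = trans (isYes≗does (i Fin.≟ i)) (dec-true (i Fin.≟ i) refl)

==ᶠ-sym : ∀ {N} (i j : Fin N) → (i ==ᶠ j) ≡ (j ==ᶠ i)
==ᶠ-sym i j with i Fin.≟ j | j Fin.≟ i
... | yes _ | yes _ = refl
... | no _ | no _ = refl
... | yes i≡j | no j≢i = ⊥-elim (j≢i (sym i≡j))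
... | no i≢j | yes j≡i = ⊥-elim (i≢j (sym j≡i))

==ᶠ-suc : ∀ {N} (i j : Fin N) → (suc i ==ᶠ suc j) ≡ (i ==ᶠ j)
==ᶠ-suc i j with i Fin.≟ j
... | yes _ = refl
... | no _ = refl

==ᶠ-exclusive : ∀ {N} {x x′ y : Fin N} → x ≢ x′ → (x ==ᶠ y) ≡ true → (x′ ==ᶠ y) ≡ false
==ᶠ-exclusive x≢x′ x==y = ≢⇒==ᶠ-false λ x′≡y → x≢x′ (trans (==ᶠ⇒≡ x==y) (sym x′≡y))

xor-cancelʳ : ∀ a t → (a xor t) xor t ≡ a
xor-cancelʳ a t = trans (Bool.xor-assoc a t t) (trans (cong (a xor_) (Bool.xor-same t)) (Bool.xor-identityʳ a))

==ᵇ-xor : ∀ a c t → ((a xor t) ==ᵇ (c xor t)) ≡ (a ==ᵇ c)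
==ᵇ-xor a c false rewrite Bool.xor-identityʳ a | Bool.xor-identityʳ c = refl
==ᵇ-xor a c true rewrite Bool.xor-comm a true | Bool.xor-comm c true = cong not (Bool.xor-annihilates-not a c)

not-xor⇒≡ : ∀ a c → not (a xor c) ≡ true → c ≡ a
not-xor⇒≡ false false _ = refl
not-xor⇒≡ true true _ = refl

𝟙 : Bool → ℕ
𝟙 true = 1
𝟙 false = 0

𝟙-∧-≤ : ∀ a b c → (a ≡ true → b ≡ true → c ≡ true) → 𝟙 (a ∧ b) ℕ.≤ 𝟙 (b ∧ c)
𝟙-∧-≤ false b c _ = ℕ.z≤n
𝟙-∧-≤ true false c _ = ℕ.z≤n
𝟙-∧-≤ true true c a⇒b⇒c rewrite a⇒b⇒c refl refl = ℕ.≤-refl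

-- Finite sums and counting

∑-const : ∀ n c → ∑[ i < n ] c ≡ n * c
∑-const zero c = refl
∑-const (suc n) c = cong (c +_) (∑-const n c)

∑-mono-≤ : ∀ {n} {f g : Fin n → ℕ} → (∀ i → f i ℕ.≤ g i) → ∑[ i < n ] f i ℕ.≤ ∑[ i < n ] g i
∑-mono-≤ {zero} f≤g = ℕ.z≤n
∑-mono-≤ {suc n} f≤g = ℕ.+-mono-≤ (f≤g zero) (∑-mono-≤ (f≤g ∘ suc))

∑-↑ : ∀ a b (f : Fin (a + b) → ℕ) →
  ∑[ i < a + b ] f i ≡ ∑[ i < a ] f (i ↑ˡ b) + ∑[ i < b ] f (a ↑ʳ i)
∑-↑ zero b f = refl
∑-↑ (suc a) b f = trans (cong (f zero +_) (∑-↑ a b (f ∘ suc))) (sym (ℕ.+-assoc (f zero) _ _))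

∑-combine : ∀ a b (f : Fin (a * b) → ℕ) →
  ∑[ i < a * b ] f i ≡ ∑[ i < a ] ∑[ j < b ] f (combine i j)
∑-combine zero b f = refl
∑-combine (suc a) b f =
  trans (∑-↑ b (a * b) f) (cong (∑[ j < b ] f (j ↑ˡ a * b) +_) (∑-combine a b (f ∘ (b ↑ʳ_))))

∑-𝟙-≡ : ∀ {n} (x : Fin n) → ∑[ y < n ] 𝟙 (x ==ᶠ y) ≡ 1
∑-𝟙-≡ {suc n} zero = cong suc (trans (∑-const n 0) (ℕ.*-zeroʳ n))
∑-𝟙-≡ {suc n} (suc x) = trans (sum-cong-≗ (cong 𝟙 ∘ ==ᶠ-suc x)) (∑-𝟙-≡ x)

∑∑-comm : ∀ {n p m q} (f : Fin n → Fin p → Fin m → Fin q → ℕ) →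
  ∑[ x < n ] ∑[ a < p ] ∑[ j < m ] ∑[ k < q ] f x a j k ≡ ∑[ j < m ] ∑[ k < q ] ∑[ x < n ] ∑[ a < p ] f x a j k
∑∑-comm {n} {p} {m} {q} f = begin
  ∑[ x < n ] ∑[ a < p ] ∑[ j < m ] ∑[ k < q ] f x a j k
    ≡⟨ sum-cong-≗ (λ x → ∑-comm λ a j → ∑[ k < q ] f x a j k) ⟩
  ∑[ x < n ] ∑[ j < m ] ∑[ a < p ] ∑[ k < q ] f x a j k
    ≡⟨ ∑-comm (λ x j → ∑[ a < p ] ∑[ k < q ] f x a j k) ⟩
  ∑[ j < m ] ∑[ x < n ] ∑[ a < p ] ∑[ k < q ] f x a j k
    ≡⟨ sum-cong-≗ (λ j → sum-cong-≗ λ x → ∑-comm λ a k → f x a j k) ⟩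
  ∑[ j < m ] ∑[ x < n ] ∑[ k < q ] ∑[ a < p ] f x a j k
    ≡⟨ sum-cong-≗ (λ j → ∑-comm λ x k → ∑[ a < p ] f x a j k) ⟩
  ∑[ j < m ] ∑[ k < q ] ∑[ x < n ] ∑[ a < p ] f x a j k ∎
  where open ≡-Reasoning

∑-bit-flip : ∀ e a → ∑[ c < 2 ] 𝟙 (e ∧ not (a ==ᵇ bit c)) ≡ 𝟙 e
∑-bit-flip false a = refl
∑-bit-flip true false = refl
∑-bit-flip true true = refl

∑-clique : ∀ e (k : Fin 4) → ∑[ l < 4 ] 𝟙 (e ∧ not (k ==ᶠ l)) ≡ 3 * 𝟙 e
∑-clique false k = refl
∑-clique true zero = refl
∑-clique true (suc zero) = refl
∑-clique true (suc (suc zero)) = refl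
∑-clique true (suc (suc (suc zero))) = refl

∑-bit-exclusive-∨ : ∀ e₁ e₂ e₃ v₁ v₂ v₃ →
  (e₁ ≡ true → e₂ ≡ false) → (e₁ ≡ true → e₃ ≡ false) → (e₂ ≡ true → e₃ ≡ false) →
  ∑[ c < 2 ] 𝟙 ((e₁ ∧ (v₁ ==ᵇ bit c)) ∨ (e₂ ∧ (v₂ ==ᵇ bit c)) ∨ (e₃ ∧ (v₃ ==ᵇ bit c)))
    ≡ 𝟙 e₁ + 𝟙 e₂ + 𝟙 e₃
∑-bit-exclusive-∨ true e₂ e₃ v₁ v₂ v₃ e₁⇒¬e₂ e₁⇒¬e₃ _ rewrite e₁⇒¬e₂ refl | e₁⇒¬e₃ refl with v₁
... | false = refl
... | true = refl
∑-bit-exclusive-∨ false true e₃ v₁ v₂ v₃ _ _ e₂⇒¬e₃ rewrite e₂⇒¬e₃ refl with v₂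
... | false = refl
... | true = refl
∑-bit-exclusive-∨ false false true v₁ v₂ v₃ _ _ _ with v₃
... | false = refl
... | true = refl
∑-bit-exclusive-∨ false false false v₁ v₂ v₃ _ _ _ = refl

count-∷ : ∀ {A : Set} (p : A → Bool) x xs → count p (x ∷ xs) ≡ 𝟙 (p x) + count p xs
count-∷ p x xs with p x
... | true = refl
... | false = refl

count-++ : ∀ {A : Set} (p : A → Bool) xs ys → count p (xs ++ ys) ≡ count p xs + count p ys
count-++ p [] ys = refl
count-++ p (x ∷ xs) ys = begin
  count p (x ∷ xs ++ ys)              ≡⟨ count-∷ p x (xs ++ ys) ⟩
  𝟙 (p x) + count p (xs ++ ys)        ≡⟨ cong (𝟙 (p x) +_) (count-++ p xs ys) ⟩
  𝟙 (p x) + (count p xs + count p ys) ≡⟨ ℕ.+-assoc (𝟙 (p x)) _ _ ⟨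
  𝟙 (p x) + count p xs + count p ys   ≡⟨ cong (_+ count p ys) (count-∷ p x xs) ⟨
  count p (x ∷ xs) + count p ys       ∎
  where open ≡-Reasoning

count-cong : ∀ {A : Set} {p q : A → Bool} → (∀ x → p x ≡ q x) → ∀ xs → count p xs ≡ count q xs
count-cong p≗q [] = refl
count-cong {p = p} {q} p≗q (x ∷ xs) = begin
  count p (x ∷ xs)        ≡⟨ count-∷ p x xs ⟩
  𝟙 (p x) + count p xs    ≡⟨ cong₂ _+_ (cong 𝟙 (p≗q x)) (count-cong p≗q xs) ⟩
  𝟙 (q x) + count q xs    ≡⟨ count-∷ q x xs ⟨
  count q (x ∷ xs)        ∎
  where open ≡-Reasoning

count-tabulate : ∀ {A : Set} (p : A → Bool) {n} (f : Fin n → A) →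
  count p (tabulate f) ≡ ∑[ i < n ] 𝟙 (p (f i))
count-tabulate p {zero} f = refl
count-tabulate p {suc n} f =
  trans (count-∷ p (f zero) _) (cong (𝟙 (p (f zero)) +_) (count-tabulate p (f ∘ suc)))

count-concatMap-tabulate : ∀ {A B : Set} (p : B → Bool) (g : A → List B) {n} (f : Fin n → A) →
  count p (concatMap g (tabulate f)) ≡ ∑[ i < n ] count p (g (f i))
count-concatMap-tabulate p g {zero} f = refl
count-concatMap-tabulate p g {suc n} f =
  trans (count-++ p (g (f zero)) _) (cong (count p (g (f zero)) +_) (count-concatMap-tabulate p g (f ∘ suc)))

count-pairs : ∀ {N} (p : Fin N × Fin N → Bool) →
  count p (concatMap (λ i → map (i ,_) (allFin N)) (allFin N)) ≡ ∑[ i < N ] ∑[ j < N ] 𝟙 (p (i , j))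
count-pairs {N} p = trans (count-concatMap-tabulate p (λ i → map (i ,_) (allFin N)) id)
  (sum-cong-≗ λ i → trans (cong (count p) (List.map-tabulate id (i ,_))) (count-tabulate p (i ,_)))

count-toList : ∀ {A : Set} (p : A → Bool) {m} (v : Vec A m) →
  count p (toList v) ≡ ∑[ j < m ] 𝟙 (p (lookup v j))
count-toList p [] = refl
count-toList p (x ∷ v) = trans (count-∷ p x (toList v)) (cong (𝟙 (p x) +_) (count-toList p v))

numSat-≤ : ∀ {n m} (𝒞 : Instance n m) τ → numSat 𝒞 τ ℕ.≤ m
numSat-≤ 𝒞 τ = ℕ.≤-trans (List.length-filter _ (toList 𝒞)) (ℕ.≤-reflexive (Vec.length-toList 𝒞))

-- Graphs

_<ᶠ_ : ∀ {N} → Fin N → Fin N → Bool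
i <ᶠ j = Fin.toℕ i ℕ.<ᵇ Fin.toℕ j

<ᶠ⇒< : ∀ {N} {i j : Fin N} → (i <ᶠ j) ≡ true → Fin.toℕ i ℕ.< Fin.toℕ j
<ᶠ⇒< {i = i} {j} i<j = ℕ.<ᵇ⇒< (Fin.toℕ i) (Fin.toℕ j) (subst T (sym i<j) tt)

<ᶠ-false⇒≥ : ∀ {N} {i j : Fin N} → (i <ᶠ j) ≡ false → Fin.toℕ j ℕ.≤ Fin.toℕ i
<ᶠ-false⇒≥ i≮j = ℕ.≮⇒≥ λ i<j → subst T i≮j (ℕ.<⇒<ᵇ i<j)

𝟙-split : ∀ {N} (i j : Fin N) b → (i ≡ j → b ≡ false) →
  𝟙 b ≡ 𝟙 ((i <ᶠ j) ∧ b) + 𝟙 ((j <ᶠ i) ∧ b)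
𝟙-split i j b diagonal with i <ᶠ j in i<j | j <ᶠ i in j<i
... | true  | true  = contradiction (<ᶠ⇒< {i = j} j<i) (ℕ.<-asym (<ᶠ⇒< {i = i} i<j))
... | true  | false = sym (ℕ.+-identityʳ (𝟙 b))
... | false | true  = refl
... | false | false = cong 𝟙 (diagonal (Fin.toℕ-injective (ℕ.≤-antisym (<ᶠ-false⇒≥ {i = j} j<i) (<ᶠ-false⇒≥ {i = i} i<j))))

Symmetric : ∀ {N} → Graph N → Set
Symmetric G = ∀ i j → adj G i j ≡ adj G j i

Loopless : ∀ {N} → Graph N → Set
Loopless G = ∀ i → adj G i i ≡ false

degreeSum : ∀ {N} → Graph N → ℕ
degreeSum {N} G = ∑[ i < N ] ∑[ j < N ] 𝟙 (adj G i j)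

handshake : ∀ {N} (G : Graph N) → Symmetric G → Loopless G → degreeSum G ≡ 2 * numEdges G
handshake {N} G symmetric loopless = begin
  degreeSum G
    ≡⟨ sum-cong-≗ (λ i → sum-cong-≗ λ j → 𝟙-split i j (adj G i j) λ { refl → loopless i }) ⟩
  ∑[ i < N ] ∑[ j < N ] (𝟙 ((i <ᶠ j) ∧ adj G i j) + 𝟙 ((j <ᶠ i) ∧ adj G i j))
    ≡⟨ sum-cong-≗ (λ i → ∑-distrib-+ (λ j → 𝟙 ((i <ᶠ j) ∧ adj G i j)) (λ j → 𝟙 ((j <ᶠ i) ∧ adj G i j))) ⟩
  ∑[ i < N ] (E i + ∑[ j < N ] 𝟙 ((j <ᶠ i) ∧ adj G i j))
    ≡⟨ ∑-distrib-+ E (λ i → ∑[ j < N ] 𝟙 ((j <ᶠ i) ∧ adj G i j)) ⟩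
  ∑[ i < N ] E i + ∑[ i < N ] ∑[ j < N ] 𝟙 ((j <ᶠ i) ∧ adj G i j)
    ≡⟨ cong (∑[ i < N ] E i +_) (∑-comm (λ i j → 𝟙 ((j <ᶠ i) ∧ adj G i j))) ⟩
  ∑[ i < N ] E i + ∑[ j < N ] ∑[ i < N ] 𝟙 ((j <ᶠ i) ∧ adj G i j)
    ≡⟨ cong (∑[ i < N ] E i +_) (sum-cong-≗ λ j → sum-cong-≗ λ i → cong (λ b → 𝟙 ((j <ᶠ i) ∧ b)) (symmetric i j)) ⟩
  ∑[ i < N ] E i + ∑[ j < N ] E j
    ≡⟨ cong (λ e → e + e) (count-pairs (λ (i , j) → (i <ᶠ j) ∧ adj G i j)) ⟨
  numEdges G + numEdges G
    ≡⟨ cong (numEdges G +_) (ℕ.+-identityʳ (numEdges G)) ⟨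
  2 * numEdges G ∎
  where
  open ≡-Reasoning
  E : Fin N → ℕ
  E i = ∑[ j < N ] 𝟙 ((i <ᶠ j) ∧ adj G i j)

_∩_ : ∀ {N} → Graph N → Graph N → Graph N
G ∩ H = record { adj = λ i j → adj G i j ∧ adj H i j }

comap : ∀ {N} → (Fin N → Fin N) → Graph N → Graph N
comap π H = record { adj = λ i j → adj H (π i) (π j) }

∩-symmetric : ∀ {N} {G H : Graph N} → Symmetric G → Symmetric H → Symmetric (G ∩ H)
∩-symmetric symG symH i j = cong₂ _∧_ (symG i j) (symH i j)

∩-looplessˡ : ∀ {N} {G : Graph N} (H : Graph N) → Loopless G → Loopless (G ∩ H)
∩-looplessˡ H looplessG i rewrite looplessG i = refl

comap-symmetric : ∀ {N} (π : Fin N → Fin N) {H : Graph N} → Symmetric H → Symmetric (comap π H)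
comap-symmetric π symH i j = symH (π i) (π j)

fromBit : Bool → Fin 2
fromBit false = zero
fromBit true = suc zero

bit-fromBit : ∀ a → bit (fromBit a) ≡ a
bit-fromBit false = refl
bit-fromBit true = refl

fromBit-bit : ∀ a → fromBit (bit a) ≡ a
fromBit-bit zero = refl
fromBit-bit (suc zero) = refl

module _ {n m : ℕ} where

  decode-var : ∀ x a → decode {n} {m} (combine x a ↑ˡ m * 4) ≡ var x (bit a)
  decode-var x a rewrite Fin.splitAt-↑ˡ (n * 2) (combine x a) (m * 4) =
    cong (λ (y , b) → var y (bit b)) (Fin.remQuot-combine x a)

  decode-con : ∀ j k → decode {n} {m} (n * 2 ↑ʳ combine j k) ≡ con j k
  decode-con j k rewrite Fin.splitAt-↑ʳ (n * 2) (m * 4) (combine j k) =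
    cong (λ (i , l) → con i l) (Fin.remQuot-combine j k)

  encode : Vtx n m → Fin (n * 2 + m * 4)
  encode (var x a) = combine x (fromBit a) ↑ˡ m * 4
  encode (con j k) = n * 2 ↑ʳ combine j k

  decode-encode : ∀ v → decode (encode v) ≡ v
  decode-encode (var x a) = trans (decode-var x (fromBit a)) (cong (var x) (bit-fromBit a))
  decode-encode (con j k) = decode-con j k

  encode-decode : ∀ i → encode (decode i) ≡ i
  encode-decode i with Fin.splitAt (n * 2) i in eq
  ... | inj₁ v = begin
    combine (proj₁ (Fin.remQuot {n} 2 v)) (fromBit (bit (proj₂ (Fin.remQuot {n} 2 v)))) ↑ˡ m * 4
      ≡⟨ cong (λ a → combine (proj₁ (Fin.remQuot {n} 2 v)) a ↑ˡ m * 4) (fromBit-bit _) ⟩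
    uncurry combine (Fin.remQuot {n} 2 v) ↑ˡ m * 4
      ≡⟨ cong (_↑ˡ m * 4) (Fin.combine-remQuot {n} 2 v) ⟩
    v ↑ˡ m * 4
      ≡⟨ Fin.splitAt⁻¹-↑ˡ eq ⟩
    i ∎
    where open ≡-Reasoning
  ... | inj₂ c = trans (cong (n * 2 ↑ʳ_) (Fin.combine-remQuot {m} 4 c)) (Fin.splitAt⁻¹-↑ʳ eq)

  ∑ᵛ : (Vtx n m → ℕ) → ℕ
  ∑ᵛ g = ∑[ x < n ] ∑[ a < 2 ] g (var x (bit a)) + ∑[ j < m ] ∑[ k < 4 ] g (con j k)

  ∑ᵛ-cong : {f g : Vtx n m → ℕ} → (∀ v → f v ≡ g v) → ∑ᵛ f ≡ ∑ᵛ g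
  ∑ᵛ-cong f≗g = cong₂ _+_ (sum-cong-≗ λ x → sum-cong-≗ λ a → f≗g (var x (bit a)))
                          (sum-cong-≗ λ j → sum-cong-≗ λ k → f≗g (con j k))

  ∑ᵛ-mono-≤ : {f g : Vtx n m → ℕ} → (∀ v → f v ℕ.≤ g v) → ∑ᵛ f ℕ.≤ ∑ᵛ g
  ∑ᵛ-mono-≤ f≤g = ℕ.+-mono-≤ (∑-mono-≤ λ x → ∑-mono-≤ λ a → f≤g (var x (bit a)))
                             (∑-mono-≤ λ j → ∑-mono-≤ λ k → f≤g (con j k))

  ∑-decode : ∀ (g : Vtx n m → ℕ) → ∑[ i < n * 2 + m * 4 ] g (decode i) ≡ ∑ᵛ g
  ∑-decode g = begin
    ∑[ i < n * 2 + m * 4 ] g (decode i)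
      ≡⟨ ∑-↑ (n * 2) (m * 4) (g ∘ decode) ⟩
    ∑[ i < n * 2 ] g (decode (i ↑ˡ m * 4)) + ∑[ i < m * 4 ] g (decode (n * 2 ↑ʳ i))
      ≡⟨ cong₂ _+_ (∑-combine n 2 _) (∑-combine m 4 _) ⟩
    ∑[ x < n ] ∑[ a < 2 ] g (decode (combine x a ↑ˡ m * 4)) + ∑[ j < m ] ∑[ k < 4 ] g (decode (n * 2 ↑ʳ combine j k))
      ≡⟨ cong₂ _+_ (sum-cong-≗ λ x → sum-cong-≗ λ a → cong g (decode-var x a))
                   (sum-cong-≗ λ j → sum-cong-≗ λ k → cong g (decode-con j k)) ⟩
    ∑ᵛ g ∎
    where open ≡-Reasoning

  ∑∑-decode : ∀ (f : Vtx n m → Vtx n m → ℕ) →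
    ∑[ i < n * 2 + m * 4 ] ∑[ j < n * 2 + m * 4 ] f (decode i) (decode j) ≡ ∑ᵛ (λ u → ∑ᵛ (f u))
  ∑∑-decode f = trans (sum-cong-≗ λ i → ∑-decode (f (decode i))) (∑-decode λ u → ∑ᵛ (f u))

-- Edge counts of G[ 𝒞 ]

module _ {n m : ℕ} (𝒞 : Instance n m) where

  adjVtx-loopless : ∀ u → adjVtx 𝒞 u u ≡ false
  adjVtx-loopless (var x a) rewrite Bool.xor-same a = Bool.∧-zeroʳ (x ==ᶠ x)
  adjVtx-loopless (con j k) rewrite ==ᶠ-refl k = Bool.∧-zeroʳ (j ==ᶠ j)

  adjVtx-symmetric : ∀ u v → adjVtx 𝒞 u v ≡ adjVtx 𝒞 v u
  adjVtx-symmetric (var x a) (var y c) rewrite ==ᶠ-sym x y | Bool.xor-comm a c = refl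
  adjVtx-symmetric (con j k) (con i l) rewrite ==ᶠ-sym j i | ==ᶠ-sym k l = refl
  adjVtx-symmetric (var x a) (con j k) = refl
  adjVtx-symmetric (con j k) (var x a) = refl

  G-loopless : Loopless G[ 𝒞 ]
  G-loopless i = adjVtx-loopless (decode i)

  G-symmetric : Symmetric G[ 𝒞 ]
  G-symmetric i j = adjVtx-symmetric (decode i) (decode j)

consistent-count : ∀ {n} (C : Eqn n) k → ∑[ y < n ] ∑[ c < 2 ] 𝟙 (consistent C k y (bit c)) ≡ 3
consistent-count {n} C k = begin
  ∑[ y < n ] ∑[ c < 2 ] 𝟙 (consistent C k y (bit c))
    ≡⟨ sum-cong-≗ (λ y → ∑-bit-exclusive-∨ (x₁ C ==ᶠ y) (x₂ C ==ᶠ y) (x₃ C ==ᶠ y) (val₁ C k) (val₂ C k) (val₃ C k)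
                           (==ᶠ-exclusive (x₁≢x₂ C)) (==ᶠ-exclusive (x₁≢x₃ C)) (==ᶠ-exclusive (x₂≢x₃ C))) ⟩
  ∑[ y < n ] (𝟙 (x₁ C ==ᶠ y) + 𝟙 (x₂ C ==ᶠ y) + 𝟙 (x₃ C ==ᶠ y))
    ≡⟨ ∑-distrib-+ (λ y → 𝟙 (x₁ C ==ᶠ y) + 𝟙 (x₂ C ==ᶠ y)) (λ y → 𝟙 (x₃ C ==ᶠ y)) ⟩
  ∑[ y < n ] (𝟙 (x₁ C ==ᶠ y) + 𝟙 (x₂ C ==ᶠ y)) + ∑[ y < n ] 𝟙 (x₃ C ==ᶠ y)
    ≡⟨ cong (_+ ∑[ y < n ] 𝟙 (x₃ C ==ᶠ y)) (∑-distrib-+ (λ y → 𝟙 (x₁ C ==ᶠ y)) (λ y → 𝟙 (x₂ C ==ᶠ y))) ⟩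
  ∑[ y < n ] 𝟙 (x₁ C ==ᶠ y) + ∑[ y < n ] 𝟙 (x₂ C ==ᶠ y) + ∑[ y < n ] 𝟙 (x₃ C ==ᶠ y)
    ≡⟨ cong₂ _+_ (cong₂ _+_ (∑-𝟙-≡ (x₁ C)) (∑-𝟙-≡ (x₂ C))) (∑-𝟙-≡ (x₃ C)) ⟩
  3 ∎
  where open ≡-Reasoning

module _ {n m : ℕ} (𝒞 : Instance n m) (s : Fin m → Bool) where

  -- The edges that translation by an assignment satisfying the equations in s preserves.
  keep : Vtx n m → Vtx n m → Bool
  keep (var _ _) (var _ _) = true
  keep (con _ _) (con _ _) = true
  keep (var _ _) (con j _) = s j
  keep (con j _) (var _ _) = s j

  keptDegree : Vtx n m → ℕ
  keptDegree u = ∑ᵛ λ v → 𝟙 (keep u v ∧ adjVtx 𝒞 u v)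

  keptToConstraints : Fin n → Bool → ℕ
  keptToConstraints x a = ∑[ j < m ] ∑[ k < 4 ] 𝟙 (s j ∧ consistent (lookup 𝒞 j) k x a)

  keptDegree-var : ∀ x a → keptDegree (var x a) ≡ 1 + keptToConstraints x a
  keptDegree-var x a = cong (_+ keptToConstraints x a)
    (trans (sum-cong-≗ λ y → ∑-bit-flip (x ==ᶠ y) a) (∑-𝟙-≡ x))

  keptDegreeToVariables : ∀ j k → ∑[ y < n ] ∑[ c < 2 ] 𝟙 (s j ∧ consistent (lookup 𝒞 j) k y (bit c)) ≡ 3 * 𝟙 (s j)
  keptDegreeToVariables j k with s j
  ... | true = consistent-count (lookup 𝒞 j) k
  ... | false = trans (∑-const n 0) (ℕ.*-zeroʳ n)

  keptDegree-con : ∀ j k → keptDegree (con j k) ≡ 3 * 𝟙 (s j) + 3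
  keptDegree-con j k = cong₂ _+_ (keptDegreeToVariables j k) (begin
    ∑[ i < m ] ∑[ l < 4 ] 𝟙 ((j ==ᶠ i) ∧ not (k ==ᶠ l)) ≡⟨ sum-cong-≗ (λ i → ∑-clique (j ==ᶠ i) k) ⟩
    ∑[ i < m ] (3 * 𝟙 (j ==ᶠ i))                      ≡⟨ *-distribˡ-sum 3 (λ i → 𝟙 (j ==ᶠ i)) ⟨
    3 * ∑[ i < m ] 𝟙 (j ==ᶠ i)                        ≡⟨ cong (3 *_) (∑-𝟙-≡ j) ⟩
    3 ∎)
    where open ≡-Reasoning

  keptDegreeSum : ∑ᵛ keptDegree ≡ 2 * (n + 6 * m + 12 * ∑[ j < m ] 𝟙 (s j))
  keptDegreeSum = begin
    ∑ᵛ keptDegree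
      ≡⟨ cong₂ _+_ (sum-cong-≗ λ x → sum-cong-≗ λ a → keptDegree-var x (bit a))
                   (sum-cong-≗ λ j → sum-cong-≗ λ k → keptDegree-con j k) ⟩
    ∑[ x < n ] ∑[ a < 2 ] (1 + keptToConstraints x (bit a)) + ∑[ j < m ] ∑[ k < 4 ] (3 * 𝟙 (s j) + 3)
      ≡⟨ cong₂ _+_ (sum-cong-≗ λ x → ∑-distrib-+ (λ _ → 1) (λ a → keptToConstraints x (bit a)))
                   (sum-cong-≗ λ j → trans (∑-const 4 (3 * 𝟙 (s j) + 3)) (quadruple (𝟙 (s j)))) ⟩
    ∑[ x < n ] (2 + ∑[ a < 2 ] keptToConstraints x (bit a)) + ∑[ j < m ] (12 * 𝟙 (s j) + 12)
      ≡⟨ cong₂ _+_ (∑-distrib-+ (λ _ → 2) (λ x → ∑[ a < 2 ] keptToConstraints x (bit a)))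
                   (∑-distrib-+ (λ j → 12 * 𝟙 (s j)) (λ _ → 12)) ⟩
    ∑[ x < n ] 2 + ∑[ x < n ] ∑[ a < 2 ] keptToConstraints x (bit a) + (∑[ j < m ] (12 * 𝟙 (s j)) + ∑[ j < m ] 12)
      ≡⟨ cong₂ _+_ (cong₂ _+_ (∑-const n 2) crossEdges) (cong₂ _+_ (sym (*-distribˡ-sum 12 (𝟙 ∘ s))) (∑-const m 12)) ⟩
    n * 2 + 12 * S + (12 * S + m * 12)
      ≡⟨ arithmetic n m S ⟩
    2 * (n + 6 * m + 12 * S) ∎
    where
    open ≡-Reasoning
    S = ∑[ j < m ] 𝟙 (s j)
    crossEdges : ∑[ x < n ] ∑[ a < 2 ] keptToConstraints x (bit a) ≡ 12 * S
    crossEdges = begin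
      ∑[ x < n ] ∑[ a < 2 ] ∑[ j < m ] ∑[ k < 4 ] 𝟙 (s j ∧ consistent (lookup 𝒞 j) k x (bit a))
        ≡⟨ ∑∑-comm (λ x a j k → 𝟙 (s j ∧ consistent (lookup 𝒞 j) k x (bit a))) ⟩
      ∑[ j < m ] ∑[ k < 4 ] ∑[ x < n ] ∑[ a < 2 ] 𝟙 (s j ∧ consistent (lookup 𝒞 j) k x (bit a))
        ≡⟨ sum-cong-≗ (λ j → trans (sum-cong-≗ (keptDegreeToVariables j)) (∑-const 4 (3 * 𝟙 (s j)))) ⟩
      ∑[ j < m ] (4 * (3 * 𝟙 (s j)))
        ≡⟨ sum-cong-≗ (λ j → ℕ.*-assoc 4 3 (𝟙 (s j))) ⟨
      ∑[ j < m ] (12 * 𝟙 (s j))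
        ≡⟨ *-distribˡ-sum 12 (𝟙 ∘ s) ⟨
      12 * S ∎
    quadruple : ∀ t → 4 * (3 * t + 3) ≡ 12 * t + 12
    quadruple = solve-∀
    arithmetic : ∀ n m S → n * 2 + 12 * S + (12 * S + m * 12) ≡ 2 * (n + 6 * m + 12 * S)
    arithmetic = solve-∀

module _ {n m : ℕ} (𝒞 : Instance n m) where

  degreeSum-G : degreeSum G[ 𝒞 ] ≡ ∑ᵛ (keptDegree 𝒞 (λ _ → true))
  degreeSum-G = trans (∑∑-decode λ u v → 𝟙 (adjVtx 𝒞 u v)) (∑ᵛ-cong λ u → ∑ᵛ-cong λ v → keep-all u v)
    where
    keep-all : ∀ u v → 𝟙 (adjVtx 𝒞 u v) ≡ 𝟙 (keep 𝒞 (λ _ → true) u v ∧ adjVtx 𝒞 u v)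
    keep-all (var _ _) (var _ _) = refl
    keep-all (var _ _) (con _ _) = refl
    keep-all (con _ _) (var _ _) = refl
    keep-all (con _ _) (con _ _) = refl

  numEdges-G : numEdges G[ 𝒞 ] ≡ n + 18 * m
  numEdges-G = ℕ.*-cancelˡ-≡ _ _ 2 (begin
    2 * numEdges G[ 𝒞 ]                          ≡⟨ handshake G[ 𝒞 ] (G-symmetric 𝒞) (G-loopless 𝒞) ⟨
    degreeSum G[ 𝒞 ]                             ≡⟨ degreeSum-G ⟩
    ∑ᵛ (keptDegree 𝒞 (λ _ → true))               ≡⟨ keptDegreeSum 𝒞 (λ _ → true) ⟩
    2 * (n + 6 * m + 12 * ∑[ j < m ] 1)          ≡⟨ cong (λ t → 2 * (n + 6 * m + 12 * t)) (trans (∑-const m 1) (ℕ.*-identityʳ m)) ⟩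
    2 * (n + 6 * m + 12 * m)                     ≡⟨ arithmetic n m ⟩
    2 * (n + 18 * m)                             ∎)
    where
    open ≡-Reasoning
    arithmetic : ∀ n m → 2 * (n + 6 * m + 12 * m) ≡ 2 * (n + 18 * m)
    arithmetic = solve-∀

-- Translation by an assignment

fromBits : Bool → Bool → Fin 4
fromBits false false = zero
fromBits false true = suc zero
fromBits true false = suc (suc zero)
fromBits true true = suc (suc (suc zero))

module _ {n} (C : Eqn n) where

  val₁-fromBits : ∀ p q → val₁ C (fromBits p q) ≡ p
  val₁-fromBits false false = refl
  val₁-fromBits false true = refl
  val₁-fromBits true false = refl
  val₁-fromBits true true = refl

  val₂-fromBits : ∀ p q → val₂ C (fromBits p q) ≡ q
  val₂-fromBits false false = refl
  val₂-fromBits false true = refl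
  val₂-fromBits true false = refl
  val₂-fromBits true true = refl

  val₃-homEqn-fromBits : ∀ p q → val₃ (homEqn C) (fromBits p q) ≡ p xor q
  val₃-homEqn-fromBits false false = refl
  val₃-homEqn-fromBits false true = refl
  val₃-homEqn-fromBits true false = refl
  val₃-homEqn-fromBits true true = refl

  fromBits-val : ∀ k → fromBits (val₁ C k) (val₂ C k) ≡ k
  fromBits-val zero = refl
  fromBits-val (suc zero) = refl
  fromBits-val (suc (suc zero)) = refl
  fromBits-val (suc (suc (suc zero))) = refl

  val₃-val : ∀ k → val₃ C k ≡ b C xor val₁ C k xor val₂ C k
  val₃-val zero = refl
  val₃-val (suc zero) = refl
  val₃-val (suc (suc zero)) = refl
  val₃-val (suc (suc (suc zero))) = refl

module _ {n} (τ : Fin n → Bool) (C : Eqn n) where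

  -- α ↦ α + τ|C on constraint vertices, in the coordinates val₁, val₂ that determine α.
  shift : Fin 4 → Fin 4
  shift k = fromBits (val₁ C k xor τ (x₁ C)) (val₂ C k xor τ (x₂ C))

  shift-involutive : ∀ k → shift (shift k) ≡ k
  shift-involutive k = begin
    fromBits (val₁ C (shift k) xor τ (x₁ C)) (val₂ C (shift k) xor τ (x₂ C))
      ≡⟨ cong₂ (λ p q → fromBits (p xor τ (x₁ C)) (q xor τ (x₂ C))) (val₁-fromBits C p q) (val₂-fromBits C p q) ⟩
    fromBits ((val₁ C k xor τ (x₁ C)) xor τ (x₁ C)) ((val₂ C k xor τ (x₂ C)) xor τ (x₂ C))
      ≡⟨ cong₂ fromBits (xor-cancelʳ (val₁ C k) (τ (x₁ C))) (xor-cancelʳ (val₂ C k) (τ (x₂ C))) ⟩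
    fromBits (val₁ C k) (val₂ C k)
      ≡⟨ fromBits-val C k ⟩
    k ∎
    where
    open ≡-Reasoning
    p = val₁ C k xor τ (x₁ C)
    q = val₂ C k xor τ (x₂ C)

  shift-injective : ∀ {k l} → shift k ≡ shift l → k ≡ l
  shift-injective {k} {l} eq = trans (sym (shift-involutive k)) (trans (cong shift eq) (shift-involutive l))

  val₃-shift : satisfies τ C ≡ true → ∀ k → val₃ (homEqn C) (shift k) ≡ val₃ C k xor τ (x₃ C)
  val₃-shift sat k = begin
    val₃ (homEqn C) (shift k)
      ≡⟨ val₃-homEqn-fromBits C (v₁ xor t₁) (v₂ xor t₂) ⟩
    (v₁ xor t₁) xor (v₂ xor t₂)
      ≡⟨ Bool.xor-identityʳ _ ⟨
    -- the solver only knows that xor is a commutative monoid, so t₃ xor t₃ = false is supplied by hand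
    ((v₁ xor t₁) xor (v₂ xor t₂)) xor false
      ≡⟨ cong (((v₁ xor t₁) xor (v₂ xor t₂)) xor_) (Bool.xor-same t₃) ⟨
    ((v₁ xor t₁) xor (v₂ xor t₂)) xor (t₃ xor t₃)
      ≡⟨ solve 5 (λ v₁ v₂ t₁ t₂ t₃ → ((v₁ ⊕ t₁) ⊕ (v₂ ⊕ t₂)) ⊕ (t₃ ⊕ t₃) ⊜ ((t₁ ⊕ (t₂ ⊕ t₃)) ⊕ (v₁ ⊕ v₂)) ⊕ t₃)
               refl v₁ v₂ t₁ t₂ t₃ ⟩
    ((t₁ xor t₂ xor t₃) xor v₁ xor v₂) xor t₃
      ≡⟨ cong (λ c → (c xor v₁ xor v₂) xor t₃) (not-xor⇒≡ (t₁ xor t₂ xor t₃) (b C) sat) ⟨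
    (b C xor v₁ xor v₂) xor t₃
      ≡⟨ cong (_xor t₃) (val₃-val C k) ⟨
    val₃ C k xor t₃ ∎
    where
    open ≡-Reasoning
    v₁ = val₁ C k
    v₂ = val₂ C k
    t₁ = τ (x₁ C)
    t₂ = τ (x₂ C)
    t₃ = τ (x₃ C)
    open import Algebra.Solver.CommutativeMonoid (CommutativeRing.+-commutativeMonoid Bool.xor-∧-commutativeRing)
      using (solve; _⊕_; _⊜_)

  ==ᶠ-∧-xor : ∀ y x v a → ((y ==ᶠ x) ∧ ((v xor τ y) ==ᵇ (a xor τ x))) ≡ ((y ==ᶠ x) ∧ (v ==ᵇ a))
  ==ᶠ-∧-xor y x v a with y Fin.≟ x
  ... | yes refl = ==ᵇ-xor v a (τ y)
  ... | no _ = refl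

  consistent-shift : satisfies τ C ≡ true → ∀ k x a →
    consistent (homEqn C) (shift k) x (a xor τ x) ≡ consistent C k x a
  consistent-shift sat k x a = begin
    consistent (homEqn C) (shift k) x (a xor τ x)
      ≡⟨ cong₂ _∨_ (cong (shifted (x₁ C)) (val₁-fromBits (homEqn C) p q))
                   (cong₂ _∨_ (cong (shifted (x₂ C)) (val₂-fromBits (homEqn C) p q))
                              (cong (shifted (x₃ C)) (val₃-shift sat k))) ⟩
    shifted (x₁ C) (val₁ C k xor τ (x₁ C)) ∨ shifted (x₂ C) (val₂ C k xor τ (x₂ C))
      ∨ shifted (x₃ C) (val₃ C k xor τ (x₃ C))
      ≡⟨ cong₂ _∨_ (==ᶠ-∧-xor (x₁ C) x (val₁ C k) a)
                   (cong₂ _∨_ (==ᶠ-∧-xor (x₂ C) x (val₂ C k) a) (==ᶠ-∧-xor (x₃ C) x (val₃ C k) a)) ⟩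
    consistent C k x a ∎
    where
    open ≡-Reasoning
    p = val₁ C k xor τ (x₁ C)
    q = val₂ C k xor τ (x₂ C)
    shifted : Fin n → Bool → Bool
    shifted y v = (y ==ᶠ x) ∧ (v ==ᵇ (a xor τ x))

module _ {n m : ℕ} (𝒞 : Instance n m) (τ : Fin n → Bool) where

  satisfiedBy : Fin m → Bool
  satisfiedBy j = satisfies τ (lookup 𝒞 j)

  shiftVtx : Vtx n m → Vtx n m
  shiftVtx (var x a) = var x (a xor τ x)
  shiftVtx (con j k) = con j (shift τ (lookup 𝒞 j) k)

  shiftVtx-involutive : ∀ v → shiftVtx (shiftVtx v) ≡ v
  shiftVtx-involutive (var x a) = cong (var x) (xor-cancelʳ a (τ x))
  shiftVtx-involutive (con j k) = cong (con j) (shift-involutive τ (lookup 𝒞 j) k)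

  shift-preserves-consistent : ∀ j k x a → satisfiedBy j ≡ true → consistent (lookup 𝒞 j) k x a ≡ true →
    consistent (lookup (homInst 𝒞) j) (shift τ (lookup 𝒞 j) k) x (a xor τ x) ≡ true
  shift-preserves-consistent j k x a sat consistent-k =
    trans (cong (λ C → consistent C (shift τ (lookup 𝒞 j) k) x (a xor τ x)) (Vec.lookup-map j homEqn 𝒞))
          (trans (consistent-shift τ (lookup 𝒞 j) sat k x a) consistent-k)

  shiftVtx-preserves-kept : ∀ u v → keep 𝒞 satisfiedBy u v ≡ true → adjVtx 𝒞 u v ≡ true →
    adjVtx (homInst 𝒞) (shiftVtx u) (shiftVtx v) ≡ true
  shiftVtx-preserves-kept (var x a) (var y c) _ adj with x Fin.≟ y
  ... | yes refl rewrite ==ᵇ-xor a c (τ x) = adj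
  ... | no _ = adj
  shiftVtx-preserves-kept (con j k) (con i l) _ adj with j Fin.≟ i
  ... | no _ = adj
  ... | yes refl with k Fin.≟ l
  ...   | yes refl = contradiction adj λ ()
  ...   | no k≢l rewrite ≢⇒==ᶠ-false (k≢l ∘ shift-injective τ (lookup 𝒞 j)) = refl
  shiftVtx-preserves-kept (var x a) (con j k) = shift-preserves-consistent j k x a
  shiftVtx-preserves-kept (con j k) (var x a) = shift-preserves-consistent j k x a

  shiftPerm : Fin (n * 2 + m * 4) → Fin (n * 2 + m * 4)
  shiftPerm = encode ∘ shiftVtx ∘ decode

  shiftPerm-involutive : ∀ i → shiftPerm (shiftPerm i) ≡ i
  shiftPerm-involutive i =
    trans (cong (encode ∘ shiftVtx) (decode-encode (shiftVtx (decode i))))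
          (trans (cong encode (shiftVtx-involutive (decode i))) (encode-decode {n} {m} i))

  preservedDegree : Vtx n m → ℕ
  preservedDegree u = ∑ᵛ λ v → 𝟙 (adjVtx 𝒞 u v ∧ adjVtx (homInst 𝒞) (shiftVtx u) (shiftVtx v))

  keptDegree-≤-preservedDegree : ∀ u → keptDegree 𝒞 satisfiedBy u ℕ.≤ preservedDegree u
  keptDegree-≤-preservedDegree u = ∑ᵛ-mono-≤ λ v →
    𝟙-∧-≤ (keep 𝒞 satisfiedBy u v) (adjVtx 𝒞 u v) (adjVtx (homInst 𝒞) (shiftVtx u) (shiftVtx v))
          (shiftVtx-preserves-kept u v)

  degreeSum-preserved : degreeSum (G[ 𝒞 ] ∩ comap shiftPerm G[ homInst 𝒞 ]) ≡ ∑ᵛ preservedDegree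
  degreeSum-preserved = trans
    (sum-cong-≗ λ i → sum-cong-≗ λ j →
       cong₂ (λ u v → 𝟙 (adjVtx 𝒞 (decode i) (decode j) ∧ adjVtx (homInst 𝒞) u v))
             (decode-encode (shiftVtx (decode i))) (decode-encode (shiftVtx (decode j))))
    (∑∑-decode λ u v → 𝟙 (adjVtx 𝒞 u v ∧ adjVtx (homInst 𝒞) (shiftVtx u) (shiftVtx v)))

  numPreserved-shiftPerm : n + 6 * m + 12 * numSat 𝒞 τ ℕ.≤ numPreserved G[ 𝒞 ] G[ homInst 𝒞 ] shiftPerm
  numPreserved-shiftPerm = ℕ.*-cancelˡ-≤ 2 (begin
    2 * (n + 6 * m + 12 * numSat 𝒞 τ)
      ≡⟨ cong (λ s → 2 * (n + 6 * m + 12 * s)) (count-toList (satisfies τ) 𝒞) ⟩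
    2 * (n + 6 * m + 12 * ∑[ j < m ] 𝟙 (satisfiedBy j))
      ≡⟨ keptDegreeSum 𝒞 satisfiedBy ⟨
    ∑ᵛ (keptDegree 𝒞 satisfiedBy)
      ≤⟨ ∑ᵛ-mono-≤ keptDegree-≤-preservedDegree ⟩
    ∑ᵛ preservedDegree
      ≡⟨ degreeSum-preserved ⟨
    degreeSum (G[ 𝒞 ] ∩ comap shiftPerm G[ homInst 𝒞 ])
      ≡⟨ handshake (G[ 𝒞 ] ∩ comap shiftPerm G[ homInst 𝒞 ])
           (∩-symmetric (G-symmetric 𝒞) (comap-symmetric shiftPerm (G-symmetric (homInst 𝒞))))
           (∩-looplessˡ {G = G[ 𝒞 ]} (comap shiftPerm G[ homInst 𝒞 ]) (G-loopless 𝒞)) ⟩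
    2 * numEdges (G[ 𝒞 ] ∩ comap shiftPerm G[ homInst 𝒞 ])
      ≡⟨⟩
    2 * numPreserved G[ 𝒞 ] G[ homInst 𝒞 ] shiftPerm ∎)
    where open ℕ.≤-Reasoning

allB-true : ∀ {A : Set} (xs : List A) {p : A → Bool} → (∀ x → p x ≡ true) → allB xs p ≡ true
allB-true [] _ = refl
allB-true (x ∷ xs) {p} all rewrite all x = allB-true xs all

anyB-true : ∀ {A : Set} {xs : List A} (p : A → Bool) {x} → x ∈ xs → p x ≡ true → anyB xs p ≡ true
anyB-true p (here refl) px rewrite px = refl
anyB-true {xs = y ∷ _} p (there x∈xs) px rewrite anyB-true p x∈xs px = Bool.∨-zeroʳ (p y)

inverse⇒isBijection : ∀ {N} (f f⁻¹ : Fin N → Fin N) →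
  (∀ i → f⁻¹ (f i) ≡ i) → (∀ i → f (f⁻¹ i) ≡ i) → isBijection f ≡ true
inverse⇒isBijection {N} f f⁻¹ left right =
  cong₂ _∧_ (allB-true (allFin N) λ i → allB-true (allFin N) λ j → injective i j)
            (allB-true (allFin N) λ y → anyB-true (λ i → f i ==ᶠ y) (∈-allFin (f⁻¹ y)) (trans (cong (_==ᶠ y) (right y)) (==ᶠ-refl y)))
  where
  injective : ∀ i j → (not (f i ==ᶠ f j) ∨ (i ==ᶠ j)) ≡ true
  injective i j with i Fin.≟ j
  ... | yes _ = Bool.∨-zeroʳ _
  ... | no i≢j rewrite ≢⇒==ᶠ-false {i = f i} {j = f j} (λ fi≡fj → i≢j (trans (sym (left i)) (trans (cong f⁻¹ fi≡fj) (left j)))) = refl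

∈-allVecs : ∀ {A : Set} (xs : List A) {k} (v : Vec A k) → (∀ i → lookup v i ∈ xs) → v ∈ allVecs xs k
∈-allVecs xs [] _ = here refl
∈-allVecs xs {suc k} (x ∷ v) all∈ = ∈-concatMap⁺ (λ y → map (y ∷_) (allVecs xs k))
  (Any.map (λ { refl → ∈-map⁺ (x ∷_) (∈-allVecs xs v (all∈ ∘ suc)) }) (all∈ zero))

≤-foldr-⊔-init : ∀ x (ys : List ℚ) → x ℚ.≤ foldr ℚ._⊔_ x ys
≤-foldr-⊔-init x [] = ℚ.≤-refl
≤-foldr-⊔-init x (y ∷ ys) = ℚ.p≤q⇒p≤r⊔q y (≤-foldr-⊔-init x ys)

≤-foldr-⊔ : ∀ x {ys : List ℚ} {q} → q ∈ ys → q ℚ.≤ foldr ℚ._⊔_ x ys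
≤-foldr-⊔ x {y ∷ ys} (here refl) = ℚ.p≤p⊔q y _
≤-foldr-⊔ x {y ∷ ys} (there q∈ys) = ℚ.p≤q⇒p≤r⊔q y (≤-foldr-⊔ x q∈ys)

≤-maxℚ : ∀ {xs : List ℚ} {q} → q ∈ xs → q ℚ.≤ maxℚ xs
≤-maxℚ {x ∷ xs} (here refl) = ≤-foldr-⊔-init x xs
≤-maxℚ {x ∷ xs} (there q∈xs) = ≤-foldr-⊔ x q∈xs

foldr-⊔-∈ : ∀ x (ys : List ℚ) → foldr ℚ._⊔_ x ys ∈ x ∷ ys
foldr-⊔-∈ x [] = here refl
foldr-⊔-∈ x (y ∷ ys) with ℚ.⊔-sel y (foldr ℚ._⊔_ x ys)
... | inj₁ ≡y rewrite ≡y = there (here refl)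
... | inj₂ ≡rest rewrite ≡rest with foldr-⊔-∈ x ys
...   | here ≡x = here ≡x
...   | there ∈ys = there (there ∈ys)

maxℚ-∈ : ∀ {xs : List ℚ} {q} → q ∈ xs → maxℚ xs ∈ xs
maxℚ-∈ {x ∷ xs} _ = foldr-⊔-∈ x xs

GI-≥ : ∀ {N} (G H : Graph N) {d} → numEdges G ℕ.⊔ numEdges H ≡ suc d →
  (f f⁻¹ : Fin N → Fin N) → (∀ i → f⁻¹ (f i) ≡ i) → (∀ i → f (f⁻¹ i) ≡ i) →
  ℤ.+ numPreserved G H f / suc d ℚ.≤ GI G H
GI-≥ {N} G H {d} E≡ f f⁻¹ left right with numEdges G ℕ.⊔ numEdges H | E≡
... | .(suc d) | refl = subst (ℚ._≤ _) (cong (λ p → ℤ.+ p / suc d) table-preserved) (≤-maxℚ (∈-map⁺ _ table∈))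
  where
  table : Vec (Fin N) N
  table = Vec.tabulate f
  lookup-table : ∀ i → lookup table i ≡ f i
  lookup-table = Vec.lookup∘tabulate f
  table∈ : table ∈ bijections N
  table∈ = ∈-filter⁺ (λ v → isBijection (lookup v) Bool.≟ true) (∈-allVecs (allFin N) table λ _ → ∈-allFin _)
    (inverse⇒isBijection (lookup table) f⁻¹
      (λ i → trans (cong f⁻¹ (lookup-table i)) (left i)) (λ i → trans (lookup-table (f⁻¹ i)) (right i)))
  table-preserved : numPreserved G H (lookup table) ≡ numPreserved G H f
  table-preserved = count-cong {q = λ (i , j) → (i <ᶠ j) ∧ adj G i j ∧ adj H (f i) (f j)}
    (λ (i , j) → cong₂ (λ u v → (i <ᶠ j) ∧ adj G i j ∧ adj H u v) (lookup-table i) (lookup-table j))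
    (concatMap (λ i → map (i ,_) (allFin N)) (allFin N))

val-attained : ∀ {n m} .{{_ : NonZero m}} (𝒞 : Instance n m) → ∃ λ τ → val 𝒞 ≡ ℤ.+ numSat 𝒞 τ / m
val-attained {n} {m} 𝒞 = lookup τ , val≡
  where
  fraction : Vec Bool n → ℚ
  fraction τ = ℤ.+ numSat 𝒞 (lookup τ) / m
  all-false∈ : Vec.replicate n false ∈ allVecs (false ∷ true ∷ []) n
  all-false∈ = ∈-allVecs _ _ λ i → subst (_∈ false ∷ true ∷ []) (sym (Vec.lookup-replicate i false)) (here refl)
  attained = ∈-map⁻ fraction (maxℚ-∈ (∈-map⁺ fraction all-false∈))
  τ = proj₁ attained
  val≡ = proj₂ (proj₂ attained)

fraction-+ : ∀ a b c d →
  ℤ.+ a ℚᵘ./ suc b ℚᵘ.+ ℤ.+ c ℚᵘ./ suc d ≡ ℤ.+ (a * suc d + c * suc b) ℚᵘ./ (suc b * suc d)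
fraction-+ a b c d = cong (λ i → i ℚᵘ./ (suc b * suc d))
  (sym (trans (ℤ.pos-+ (a * suc d) (c * suc b)) (cong₂ ℤ._+_ (ℤ.pos-* a (suc d)) (ℤ.pos-* c (suc b)))))

fraction-* : ∀ a b c d → (ℤ.+ a ℚᵘ./ suc b) ℚᵘ.* (ℤ.+ c ℚᵘ./ suc d) ≡ ℤ.+ (a * c) ℚᵘ./ (suc b * suc d)
fraction-* a b c d = cong (λ i → i ℚᵘ./ (suc b * suc d)) (sym (ℤ.pos-* a c))

fraction-≤ : ∀ {a b c d} → a * suc d ℕ.≤ c * suc b → ℤ.+ a ℚᵘ./ suc b ℚᵘ.≤ ℤ.+ c ℚᵘ./ suc d
fraction-≤ {a} {b} {c} {d} ad≤cb = ℚᵘ.*≤* (subst₂ ℤ._≤_ (ℤ.pos-* a (suc d)) (ℤ.pos-* c (suc b)) (ℤ.+≤+ ad≤cb))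

toℚᵘ-fraction : ∀ a b → ℚ.toℚᵘ (ℤ.+ a / suc b) ℚᵘ.≃ ℤ.+ a ℚᵘ./ suc b
toℚᵘ-fraction a b = ℚ.toℚᵘ-fromℚᵘ (ℤ.+ a ℚᵘ./ suc b)

interpolate-≤ : ∀ c .{{_ : ℚ.NonNegative c}} {ε x} → 1ℚ ℚ.- ε ℚ.≤ x →
  1ℚ ℚ.- c ℚ.* ε ℚ.≤ (1ℚ ℚ.- c) ℚ.+ c ℚ.* x
interpolate-≤ c {ε} {x} 1-ε≤x = begin
  1ℚ ℚ.- c ℚ.* ε                  ≡⟨ solve 2 (λ c ε → con 1ℚ :- c :* ε := (con 1ℚ :- c) :+ c :* (con 1ℚ :- ε)) refl c ε ⟩
  (1ℚ ℚ.- c) ℚ.+ c ℚ.* (1ℚ ℚ.- ε) ≤⟨ ℚ.+-monoʳ-≤ (1ℚ ℚ.- c) (ℚ.*-monoˡ-≤-nonNeg c 1-ε≤x) ⟩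
  (1ℚ ℚ.- c) ℚ.+ c ℚ.* x          ∎
  where
  open ℚ.≤-Reasoning
  open +-*-Solver

one-third-plus-two-thirds-≤ : ∀ s m′ P d → (suc m′ + 2 * s) * suc d ℕ.≤ P * (3 * suc m′) →
  (1ℚ ℚ.- ℤ.+ 2 / 3) ℚ.+ (ℤ.+ 2 / 3) ℚ.* (ℤ.+ s / suc m′) ℚ.≤ ℤ.+ P / suc d
-- Computed in ℚᵘ, whose sums and products of fractions are not normalised.
one-third-plus-two-thirds-≤ s m′ P d hyp =
  ℚ.toℚᵘ-cancel-≤ (ℚᵘ.≤-respʳ-≃ (ℚᵘ.≃-sym (toℚᵘ-fraction P d)) (ℚᵘ.≤-respˡ-≃ (ℚᵘ.≃-sym lhs≃) (fraction-≤ cross)))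
  where
  M = suc m′
  lhs≃ : ℚ.toℚᵘ ((1ℚ ℚ.- ℤ.+ 2 / 3) ℚ.+ (ℤ.+ 2 / 3) ℚ.* (ℤ.+ s / M))
         ℚᵘ.≃ ℤ.+ (1 * (3 * M) + 2 * s * 3) ℚᵘ./ (3 * (3 * M))
  lhs≃ = begin-equality
    ℚ.toℚᵘ ((1ℚ ℚ.- ℤ.+ 2 / 3) ℚ.+ (ℤ.+ 2 / 3) ℚ.* (ℤ.+ s / M))
      ≃⟨ ℚ.toℚᵘ-homo-+ (1ℚ ℚ.- ℤ.+ 2 / 3) ((ℤ.+ 2 / 3) ℚ.* (ℤ.+ s / M)) ⟩
    ℤ.+ 1 ℚᵘ./ 3 ℚᵘ.+ ℚ.toℚᵘ ((ℤ.+ 2 / 3) ℚ.* (ℤ.+ s / M))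
      ≃⟨ ℚᵘ.+-congʳ (ℤ.+ 1 ℚᵘ./ 3) (ℚ.toℚᵘ-homo-* (ℤ.+ 2 / 3) (ℤ.+ s / M)) ⟩
    ℤ.+ 1 ℚᵘ./ 3 ℚᵘ.+ ℤ.+ 2 ℚᵘ./ 3 ℚᵘ.* ℚ.toℚᵘ (ℤ.+ s / M)
      ≃⟨ ℚᵘ.+-congʳ (ℤ.+ 1 ℚᵘ./ 3) (ℚᵘ.*-congˡ {ℤ.+ 2 ℚᵘ./ 3} (toℚᵘ-fraction s m′)) ⟩
    ℤ.+ 1 ℚᵘ./ 3 ℚᵘ.+ (ℤ.+ 2 ℚᵘ./ 3) ℚᵘ.* (ℤ.+ s ℚᵘ./ M)
      ≡⟨ cong (ℤ.+ 1 ℚᵘ./ 3 ℚᵘ.+_) (fraction-* 2 2 s m′) ⟩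
    ℤ.+ 1 ℚᵘ./ 3 ℚᵘ.+ ℤ.+ (2 * s) ℚᵘ./ (3 * M)
      ≡⟨ fraction-+ 1 2 (2 * s) (m′ + 2 * M) ⟩
    ℤ.+ (1 * (3 * M) + 2 * s * 3) ℚᵘ./ (3 * (3 * M)) ∎
    where open ℚᵘ.≤-Reasoning
  cross : (1 * (3 * M) + 2 * s * 3) * suc d ℕ.≤ P * (3 * (3 * M))
  cross = begin
    (1 * (3 * M) + 2 * s * 3) * suc d   ≡⟨ lhs-triple s M d ⟩
    3 * ((M + 2 * s) * suc d)           ≤⟨ ℕ.*-monoʳ-≤ 3 hyp ⟩
    3 * (P * (3 * M))                   ≡⟨ rhs-triple P M ⟩
    P * (3 * (3 * M))                   ∎
    where
    open ℕ.≤-Reasoning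
    lhs-triple : ∀ s M d → (1 * (3 * M) + 2 * s * 3) * suc d ≡ 3 * ((M + 2 * s) * suc d)
    lhs-triple = solve-∀
    rhs-triple : ∀ P M → 3 * (P * (3 * M)) ≡ P * (3 * (3 * M))
    rhs-triple = solve-∀

preserved-ratio-cross : ∀ n M s P → s ℕ.≤ M → n + 6 * M + 12 * s ℕ.≤ P →
  (M + 2 * s) * (18 * M + n) ℕ.≤ P * (3 * M)
preserved-ratio-cross n M s P s≤M preserved = begin
  (M + 2 * s) * (18 * M + n)                          ≡⟨ expand n M s ⟩
  M * n + 18 * (M * M) + 36 * (M * s) + 2 * (s * n)   ≤⟨ ℕ.+-monoʳ-≤ (M * n + 18 * (M * M) + 36 * (M * s))
                                                            (ℕ.*-monoʳ-≤ 2 (ℕ.*-monoˡ-≤ n s≤M)) ⟩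
  M * n + 18 * (M * M) + 36 * (M * s) + 2 * (M * n)   ≡⟨ collect n M s ⟩
  (n + 6 * M + 12 * s) * (3 * M)                      ≤⟨ ℕ.*-monoˡ-≤ (3 * M) preserved ⟩
  P * (3 * M)                                         ∎
  where
  open ℕ.≤-Reasoning
  expand : ∀ n M s → (M + 2 * s) * (18 * M + n) ≡ M * n + 18 * (M * M) + 36 * (M * s) + 2 * (s * n)
  expand = solve-∀
  collect : ∀ n M s → M * n + 18 * (M * M) + 36 * (M * s) + 2 * (M * n) ≡ (n + 6 * M + 12 * s) * (3 * M)
  collect = solve-∀

approximation-≤ : ∀ n m′ s P ε → s ℕ.≤ suc m′ → n + 6 * suc m′ + 12 * s ℕ.≤ P →
  1ℚ ℚ.- ε ℚ.≤ ℤ.+ s / suc m′ → 1ℚ ℚ.- (ℤ.+ 2 / 3) ℚ.* ε ℚ.≤ ℤ.+ P / (18 * suc m′ + n)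
approximation-≤ n m′ s P ε s≤m preserved 1-ε≤s/m = ℚ.≤-trans (interpolate-≤ (ℤ.+ 2 / 3) {ε} 1-ε≤s/m)
  (one-third-plus-two-thirds-≤ s m′ P _ (preserved-ratio-cross n (suc m′) s P s≤m preserved))

lemma4p1 : ∀ {n m : ℕ} .{{_ : NonZero m}} (𝒞 : Instance n m) (ε : ℚ) →
    1ℚ ℚ.- ε ℚ.≤ val 𝒞 →
    1ℚ ℚ.- (ℤ.+ 2 / 3) ℚ.* ε ℚ.≤ GI G[ 𝒞 ] G[ homInst 𝒞 ]
lemma4p1 {n} {suc m′} 𝒞 ε 1-ε≤val = ℚ.≤-trans ratio
  (GI-≥ G[ 𝒞 ] G[ homInst 𝒞 ] edges (shiftPerm 𝒞 τ) (shiftPerm 𝒞 τ) (shiftPerm-involutive 𝒞 τ) (shiftPerm-involutive 𝒞 τ))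
  where
  τ = proj₁ (val-attained 𝒞)
  -- In this order the edge count reduces to a successor, the form GI-≥ needs.
  edges : numEdges G[ 𝒞 ] ℕ.⊔ numEdges G[ homInst 𝒞 ] ≡ 18 * suc m′ + n
  edges = trans (cong₂ ℕ._⊔_ (numEdges-G 𝒞) (numEdges-G (homInst 𝒞)))
                (trans (ℕ.⊔-idem (n + 18 * suc m′)) (ℕ.+-comm n (18 * suc m′)))
  ratio : 1ℚ ℚ.- (ℤ.+ 2 / 3) ℚ.* ε ℚ.≤ ℤ.+ numPreserved G[ 𝒞 ] G[ homInst 𝒞 ] (shiftPerm 𝒞 τ) / (18 * suc m′ + n)
  ratio = approximation-≤ n m′ (numSat 𝒞 τ) (numPreserved G[ 𝒞 ] G[ homInst 𝒞 ] (shiftPerm 𝒞 τ)) ε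
            (numSat-≤ 𝒞 τ) (numPreserved-shiftPerm 𝒞 τ) (subst (1ℚ ℚ.- ε ℚ.≤_) (proj₂ (val-attained 𝒞)) 1-ε≤val)
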